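{- For every positive integer $n$, the star $K_{1,n}$ satisfies $\chi_\rho''(K_{1,n}) = n+2$.
   Context: All graphs are simple, finite and undirected. $K_{1,n}$ is the star with one central vertex adjacent to $n$ leaves. The total graph $T(G)$ of a graph $G$ has vertex set $V(G)\cup E(G)$, where two elements are adjacent if they are adjacent vertices of $G$, incident edges of $G$ (sharing an endpoint), or a vertex and an edge of $G$ having that vertex as an endpoint. A packing total coloring of $G$ is a map $c:V(G)\cup E(G)\to\{1,2,\dots\}$ such that for any two distinct elements $A,B\in V(G)\cup E(G)$ with $c(A)=c(B)=i$, the distance between $A$ and $B$ in $T(G)$ is greater than $i$. The packing total chromatic number $\chi_\rho''(G)$ is the smallest $k$ such that $G$ has a packing total coloring with colors from $\{1,\dots,k\}$. -}

module Defs where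

open import Level using (0ℓ)
open import Data.Nat using (ℕ; zero; suc; _≤_; _+_)
open import Data.Fin using (Fin; zero; suc)
open import Data.Sum using (_⊎_; inj₁; inj₂)
open import Data.Product using (Σ; _×_; _,_; ∃; ∃-syntax)
open import Relation.Binary.PropositionalEquality using (_≡_; _≢_)
open import Relation.Nullary using (¬_)

record Graph : Set₁ where
  field
    nV   : ℕ
    nE   : ℕ
    end₁ : Fin nE → Fin nV
    end₂ : Fin nE → Fin nV
    loopless : ∀ e → end₁ e ≢ end₂ e
    noMulti  : ∀ e f → ((end₁ e ≡ end₁ f × end₂ e ≡ end₂ f) ⊎ (end₁ e ≡ end₂ f × end₂ e ≡ end₁ f)) → e ≡ f

  Vtx : Set
  Vtx = Fin nV

  Edg : Set
  Edg = Fin nE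

  _∈ₑ_ : Vtx → Edg → Set
  v ∈ₑ e = (v ≡ end₁ e) ⊎ (v ≡ end₂ e)

  -- elements of G: vertices and edges (vertex set of the total graph T(G))
  Elem : Set
  Elem = Vtx ⊎ Edg

  TAdj : Elem → Elem → Set
  TAdj (inj₁ u) (inj₁ v) = Σ Edg λ e → (u ≡ end₁ e × v ≡ end₂ e) ⊎ (u ≡ end₂ e × v ≡ end₁ e)
  TAdj (inj₂ e) (inj₂ f) = e ≢ f × Σ Vtx λ v → v ∈ₑ e × v ∈ₑ f
  TAdj (inj₁ v) (inj₂ e) = v ∈ₑ e
  TAdj (inj₂ e) (inj₁ v) = v ∈ₑ e

  data Walk : ℕ → Elem → Elem → Set where
    here : ∀ {A} → Walk zero A A
    step : ∀ {k A B C} → TAdj A B → Walk k B C → Walk (suc k) A C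

  DistLe : Elem → Elem → ℕ → Set
  DistLe A B i = ∃[ k ] (k ≤ i × Walk k A B)

  IsPackingTotalColoring : ℕ → (Elem → ℕ) → Set
  IsPackingTotalColoring k c =
    (∀ A → 1 ≤ c A × c A ≤ k) ×
    (∀ A B → A ≢ B → c A ≡ c B → ¬ DistLe A B (c A))

  HasPackingTotalColoring : ℕ → Set
  HasPackingTotalColoring k = Σ (Elem → ℕ) (IsPackingTotalColoring k)

  PackingTotalChromaticNumber≡ : ℕ → Set
  PackingTotalChromaticNumber≡ k =
    HasPackingTotalColoring k × (∀ k′ → HasPackingTotalColoring k′ → k ≤ k′)

private
  sucInj : ∀ {m} {i j : Fin m} → Fin.suc i ≡ suc j → i ≡ j
  sucInj Relation.Binary.PropositionalEquality.refl = Relation.Binary.PropositionalEquality.refl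

star : ℕ → Graph
star n = record
  { nV = suc n
  ; nE = n
  ; end₁ = λ _ → zero
  ; end₂ = λ i → suc i
  ; loopless = λ e ()
  ; noMulti = λ { e f (inj₁ (_ , p)) → sucInj p ; e f (inj₂ (() , _)) }
  }

-- The centre together with the n edges forms a clique of size n + 1 in the
-- total graph, so these elements get n + 1 distinct colours.  Two elements at
-- distance two may share a colour only if it is 1, so at most one edge has
-- colour 1; the leaf at the end of that edge (or any leaf, if there is no
-- such edge) is adjacent to the centre and its own edge and at distance two
-- from every other edge, hence needs an (n + 2)-nd colour.  Conversely,
-- colouring the centre 2, one leaf n + 2, the edge at that leaf and all other
-- leaves 1, and the remaining edges 3, …, n + 1 is a packing total colouring.
module Submission where

open import Defs
open import Data.Nat using (ℕ; zero; suc; _≤_; _<_; _+_; _∸_; z≤n; s≤s)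
import Data.Nat as ℕ
open import Data.Nat.Properties using (≤∧≢⇒<; +-comm; ≤-reflexive; ≤-trans; <⇒≤; <-irrefl; ∸-cancelʳ-≡)
open import Data.Fin using (Fin; zero; suc; toℕ; fromℕ<; _≟_)
open import Data.Fin.Properties using (toℕ<n; toℕ-injective; fromℕ<-injective; any?; injective⇒≤)
open import Data.Sum using (_⊎_; inj₁; inj₂; [_,_]′)
open import Data.Product using (Σ; _×_; _,_; proj₁; proj₂)
open import Data.Empty using (⊥-elim)
open import Function using (_∘_)
open import Function.Definitions using (Injective)
open import Relation.Nullary using (¬_; yes; no)
open import Relation.Binary.PropositionalEquality using (_≡_; _≢_; refl; sym; trans; cong; subst)

module _ (G : Graph) where
  open Graph G

  TAdj⇒≢ : ∀ {A B} → TAdj A B → A ≢ B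
  TAdj⇒≢ {inj₁ _} (_ , inj₁ (p , q)) refl = loopless _ (trans (sym p) q)
  TAdj⇒≢ {inj₁ _} (_ , inj₂ (p , q)) refl = loopless _ (trans (sym q) p)
  TAdj⇒≢ {inj₂ _} (e≢e , _) refl = e≢e refl

  DistLe₁⇒≡⊎TAdj : ∀ {A B} → DistLe A B 1 → A ≡ B ⊎ TAdj A B
  DistLe₁⇒≡⊎TAdj (zero , _ , here) = inj₁ refl
  DistLe₁⇒≡⊎TAdj (suc zero , _ , step A~B here) = inj₂ A~B
  DistLe₁⇒≡⊎TAdj (suc (suc _) , s≤s () , _)

  module PackingTotalColoring {k : ℕ} {c : Elem → ℕ} (isColoring : IsPackingTotalColoring k c) where

    private
      1≤c : ∀ A → 1 ≤ c A
      1≤c A = proj₁ (proj₁ isColoring A)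

      c∸1<k : ∀ A → c A ∸ 1 < k
      c∸1<k A with c A | proj₁ isColoring A
      ... | suc _ | _ , c≤k = c≤k

      packing : ∀ A B → A ≢ B → c A ≡ c B → ¬ DistLe A B (c A)
      packing = proj₂ isColoring

    TAdj⇒colour≢ : ∀ {A B} → TAdj A B → c A ≢ c B
    TAdj⇒colour≢ {A} A~B same = packing A _ (TAdj⇒≢ A~B) same (1 , 1≤c A , step A~B here)

    distance₂⇒colour≡1 : ∀ {A X B} → A ≢ B → TAdj A X → TAdj X B → c A ≡ c B → c A ≡ 1
    distance₂⇒colour≡1 {A} A≢B A~X X~B same with c A ℕ.≟ 1
    ... | yes c≡1 = c≡1
    ... | no  c≢1 = ⊥-elim (packing A _ A≢B same (2 , ≤∧≢⇒< (1≤c A) (c≢1 ∘ sym) , step A~X (step X~B here)))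

    distinctColours⇒≤ : ∀ {p} (f : Fin p → Elem) → Injective _≡_ _≡_ (c ∘ f) → p ≤ k
    distinctColours⇒≤ {p} f inj = injective⇒≤ {f = colourIndex} λ {i} {j} eq →
      inj (∸-cancelʳ-≡ (1≤c (f i)) (1≤c (f j))
            (fromℕ<-injective _ _ (c∸1<k (f i)) (c∸1<k (f j)) eq))
      where
      colourIndex : Fin p → Fin k
      colourIndex i = fromℕ< (c∸1<k (f i))

pattern centre = inj₁ zero
pattern leaf i = inj₁ (suc i)
pattern edge i = inj₂ i

-- The star has n = suc m leaves, so that leaf 0 and edge 0 always exist.
module Star (m : ℕ) where
  open Graph (star (suc m))

  colour : Elem → ℕ
  colour centre         = 2
  colour (leaf zero)    = 2 + suc m
  colour (leaf (suc _)) = 1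
  colour (edge zero)    = 1
  colour (edge (suc i)) = 3 + toℕ i

  1≤colour : ∀ A → 1 ≤ colour A
  1≤colour centre         = s≤s z≤n
  1≤colour (leaf zero)    = s≤s z≤n
  1≤colour (leaf (suc _)) = s≤s z≤n
  1≤colour (edge zero)    = s≤s z≤n
  1≤colour (edge (suc _)) = s≤s z≤n

  colour≤n+2 : ∀ A → colour A ≤ 2 + suc m
  colour≤n+2 centre         = s≤s (s≤s z≤n)
  colour≤n+2 (leaf zero)    = ≤-reflexive refl
  colour≤n+2 (leaf (suc _)) = s≤s z≤n
  colour≤n+2 (edge zero)    = s≤s z≤n
  colour≤n+2 (edge (suc i)) = s≤s (s≤s (s≤s (<⇒≤ (toℕ<n i))))

  m≢toℕ : (i : Fin m) → m ≢ toℕ i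
  m≢toℕ i m≡i = <-irrefl (sym m≡i) (toℕ<n i)

  colour≡⇒≡⊎colour≡1 : ∀ A B → colour A ≡ colour B → A ≡ B ⊎ colour A ≡ 1
  colour≡⇒≡⊎colour≡1 (leaf (suc _)) _ _ = inj₂ refl
  colour≡⇒≡⊎colour≡1 (edge zero)    _ _ = inj₂ refl
  colour≡⇒≡⊎colour≡1 centre         centre         _  = inj₁ refl
  colour≡⇒≡⊎colour≡1 centre         (leaf zero)    ()
  colour≡⇒≡⊎colour≡1 centre         (leaf (suc _)) ()
  colour≡⇒≡⊎colour≡1 centre         (edge zero)    ()
  colour≡⇒≡⊎colour≡1 centre         (edge (suc _)) ()
  colour≡⇒≡⊎colour≡1 (leaf zero)    centre         ()
  colour≡⇒≡⊎colour≡1 (leaf zero)    (leaf zero)    _  = inj₁ refl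
  colour≡⇒≡⊎colour≡1 (leaf zero)    (leaf (suc _)) ()
  colour≡⇒≡⊎colour≡1 (leaf zero)    (edge zero)    ()
  colour≡⇒≡⊎colour≡1 (leaf zero)    (edge (suc j)) eq = ⊥-elim (m≢toℕ j (cong (_∸ 3) eq))
  colour≡⇒≡⊎colour≡1 (edge (suc _)) centre         ()
  colour≡⇒≡⊎colour≡1 (edge (suc i)) (leaf zero)    eq = ⊥-elim (m≢toℕ i (cong (_∸ 3) (sym eq)))
  colour≡⇒≡⊎colour≡1 (edge (suc _)) (leaf (suc _)) ()
  colour≡⇒≡⊎colour≡1 (edge (suc _)) (edge zero)    ()
  colour≡⇒≡⊎colour≡1 (edge (suc i)) (edge (suc j)) eq =
    inj₁ (cong (λ j → edge (suc j)) (toℕ-injective (cong (_∸ 3) eq)))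

  colour≡1⇒¬TAdj : ∀ A B → colour A ≡ 1 → colour B ≡ 1 → ¬ TAdj A B
  colour≡1⇒¬TAdj centre         _ () _
  colour≡1⇒¬TAdj (leaf zero)    _ () _
  colour≡1⇒¬TAdj (edge (suc _)) _ () _
  colour≡1⇒¬TAdj _ centre         _ ()
  colour≡1⇒¬TAdj _ (leaf zero)    _ ()
  colour≡1⇒¬TAdj _ (edge (suc _)) _ ()
  colour≡1⇒¬TAdj (leaf (suc _)) (leaf (suc _)) _ _ (_ , inj₁ (() , _))
  colour≡1⇒¬TAdj (leaf (suc _)) (leaf (suc _)) _ _ (_ , inj₂ (_ , ()))
  colour≡1⇒¬TAdj (leaf (suc _)) (edge zero)    _ _ (inj₁ ())
  colour≡1⇒¬TAdj (leaf (suc _)) (edge zero)    _ _ (inj₂ ())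
  colour≡1⇒¬TAdj (edge zero)    (leaf (suc _)) _ _ (inj₁ ())
  colour≡1⇒¬TAdj (edge zero)    (leaf (suc _)) _ _ (inj₂ ())
  colour≡1⇒¬TAdj (edge zero)    (edge zero)    _ _ (0≢0 , _) = 0≢0 refl

  colour-packing : ∀ A B → A ≢ B → colour A ≡ colour B → ¬ DistLe A B (colour A)
  colour-packing A B A≢B same with colour≡⇒≡⊎colour≡1 A B same
  ... | inj₁ A≡B = ⊥-elim (A≢B A≡B)
  ... | inj₂ c≡1 = subst (λ i → ¬ DistLe A B i) (sym c≡1)
    λ d → [ A≢B , colour≡1⇒¬TAdj A B c≡1 (trans (sym same) c≡1) ]′ (DistLe₁⇒≡⊎TAdj (star (suc m)) d)

  colour-isPackingTotalColoring : IsPackingTotalColoring (suc m + 2) colour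
  colour-isPackingTotalColoring =
    (λ A → 1≤colour A , ≤-trans (colour≤n+2 A) (≤-reflexive (+-comm 2 (suc m)))) , colour-packing

  edge-TAdj : ∀ {i j} → i ≢ j → TAdj (edge i) (edge j)
  edge-TAdj i≢j = i≢j , zero , inj₁ refl , inj₁ refl

  centreOrEdge : Fin (suc (suc m)) → Elem
  centreOrEdge zero    = centre
  centreOrEdge (suc i) = edge i

  centreOrEdge-clique : ∀ i j → i ≢ j → TAdj (centreOrEdge i) (centreOrEdge j)
  centreOrEdge-clique zero    zero    0≢0 = ⊥-elim (0≢0 refl)
  centreOrEdge-clique zero    (suc _) _   = inj₁ refl
  centreOrEdge-clique (suc _) zero    _   = inj₁ refl
  centreOrEdge-clique (suc _) (suc _) i≢j = edge-TAdj (i≢j ∘ cong suc)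

  leaf-TAdj-centre : ∀ ℓ → TAdj (leaf ℓ) centre
  leaf-TAdj-centre ℓ = ℓ , inj₂ (refl , refl)

  module LowerBound {k : ℕ} {c : Elem → ℕ} (isColoring : IsPackingTotalColoring k c) where
    open PackingTotalColoring (star (suc m)) isColoring

    clique-colours-injective : ∀ i j → c (centreOrEdge i) ≡ c (centreOrEdge j) → i ≡ j
    clique-colours-injective i j same with i ≟ j
    ... | yes i≡j = i≡j
    ... | no  i≢j = ⊥-elim (TAdj⇒colour≢ (centreOrEdge-clique i j i≢j) same)

    otherEdges-colour≢1 : Σ (Fin (suc m)) λ ℓ → ∀ j → j ≢ ℓ → c (edge j) ≢ 1
    otherEdges-colour≢1 with any? (λ i → c (edge i) ℕ.≟ 1)
    ... | yes (i , cᵢ≡1) = i , λ j j≢i cⱼ≡1 → TAdj⇒colour≢ (edge-TAdj j≢i) (trans cⱼ≡1 (sym cᵢ≡1))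
    ... | no  ∄i         = zero , λ j _ cⱼ≡1 → ∄i (j , cⱼ≡1)

    ℓ : Fin (suc m)
    ℓ = proj₁ otherEdges-colour≢1

    leaf-colour≢clique-colour : ∀ i → c (leaf ℓ) ≢ c (centreOrEdge i)
    leaf-colour≢clique-colour zero same = TAdj⇒colour≢ (leaf-TAdj-centre ℓ) same
    leaf-colour≢clique-colour (suc j) same with j ≟ ℓ
    ... | yes refl = TAdj⇒colour≢ (inj₂ refl) same
    ... | no  j≢ℓ  = proj₂ otherEdges-colour≢1 j j≢ℓ
      (trans (sym same) (distance₂⇒colour≡1 {X = centre} (λ ()) (leaf-TAdj-centre ℓ) (inj₁ refl) same))

    witnesses : Fin (suc (suc (suc m))) → Elem
    witnesses zero    = leaf ℓ
    witnesses (suc i) = centreOrEdge i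

    witness-colours-injective : ∀ i j → c (witnesses i) ≡ c (witnesses j) → i ≡ j
    witness-colours-injective zero    zero    _    = refl
    witness-colours-injective zero    (suc j) same = ⊥-elim (leaf-colour≢clique-colour j same)
    witness-colours-injective (suc i) zero    same = ⊥-elim (leaf-colour≢clique-colour i (sym same))
    witness-colours-injective (suc i) (suc j) same = cong suc (clique-colours-injective i j same)

    n+2≤k : suc m + 2 ≤ k
    n+2≤k = subst (_≤ k) (+-comm 2 (suc m))
      (distinctColours⇒≤ witnesses (witness-colours-injective _ _))

mainTheorem2 : ∀ (n : ℕ) → 1 ≤ n → Graph.PackingTotalChromaticNumber≡ (star n) (n + 2)
mainTheorem2 (suc m) _ =
  (Star.colour m , Star.colour-isPackingTotalColoring m) ,
  λ k (c , isColoring) → Star.LowerBound.n+2≤k m isColoring
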